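{- For a strong divisibility sequence $C$, a prime $p$, and an integer $n\ge0$, \[ \nu_p(n!_C)=\sum_{k\ge1}\left\lfloor\frac{n}{\alpha(p^k)}\right\rfloor, \] where a term with $\alpha(p^k)=\infty$ is interpreted as $0$.
   Context: A strong divisibility sequence is a sequence $C=C_1,C_2,\dots$ of nonzero integers with $\gcd(C_n,C_m)=C_{\gcd(n,m)}$ for all positive $n,m$. The $C$-orial is $0!_C=1$, $n!_C=C_nC_{n-1}\cdots C_1$ for $n\ge1$. $\nu_p$ is the $p$-adic valuation. The rank of apparition $\alpha(m)$ is the least index $j\ge1$ with $m\mid C_j$; if no such $j$ exists, $\alpha(m)=\infty$. -}

module Defs where

open import Data.Nat using (ℕ; zero; suc; _+_; _*_; _^_; _≤_; _<_; _/_)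
open import Data.Nat.GCD using (gcd)
open import Data.Integer using (ℤ; +_; ∣_∣) renaming (_*_ to _*ℤ_; 1ℤ to 1ℤ)
open import Data.Integer.Divisibility using (_∣_)
open import Data.Integer.GCD renaming (gcd to gcdℤ)
open import Data.Maybe using (Maybe; just; nothing)
open import Data.Product using (_×_; ∃)
open import Relation.Nullary using (¬_)
open import Relation.Binary.PropositionalEquality using (_≡_; _≢_)

-- A sequence C₁, C₂, … of integers, represented as C : ℕ → ℤ (the value at 0 is ignored).
-- Strong divisibility sequence: all terms C_n (n ≥ 1) nonzero and
-- gcd(C_n, C_m) = C_{gcd(n,m)} (up to sign, since gcd is nonnegative).
record IsStrongDivSeq (C : ℕ → ℤ) : Set where
  field
    nonzero : ∀ n → 1 ≤ n → C n ≢ + 0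
    sdiv    : ∀ n m → 1 ≤ n → 1 ≤ m → gcdℤ (C n) (C m) ≡ + ∣ C (gcd n m) ∣

orial : (ℕ → ℤ) → ℕ → ℤ
orial C zero    = 1ℤ
orial C (suc n) = C (suc n) *ℤ orial C n

-- Rank of apparition, with ∞ represented by nothing:
-- Rank C m (just j) : j is the least index j ≥ 1 with m ∣ C_j;
-- Rank C m nothing  : there is no index j ≥ 1 with m ∣ C_j.
Rank : (ℕ → ℤ) → ℕ → Maybe ℕ → Set
Rank C m (just j) = 1 ≤ j × (+ m ∣ C j) × (∀ i → 1 ≤ i → i < j → ¬ (+ m ∣ C i))
Rank C m nothing  = ∀ j → 1 ≤ j → ¬ (+ m ∣ C j)

-- ⌊n / a⌋ with the convention that a = ∞ gives 0.  (a = just 0 never occurs for a rank.)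
floorDivRank : ℕ → Maybe ℕ → ℕ
floorDivRank n nothing        = 0
floorDivRank n (just zero)    = 0
floorDivRank n (just (suc j)) = n / suc j

sumFrom1 : (ℕ → ℕ) → ℕ → ℕ
sumFrom1 t zero    = 0
sumFrom1 t (suc K) = sumFrom1 t K + t (suc K)

HasSum : (ℕ → ℕ) → ℕ → Set
HasSum t s = ∃ λ K → ∀ K' → K ≤ K' → sumFrom1 t K' ≡ s

IsValuation : ℕ → ℤ → ℕ → Set
IsValuation p x v = (+ (p ^ v) ∣ x) × ¬ (+ (p ^ suc v) ∣ x)

-- Strong divisibility makes p^k ∣ C_j equivalent to α(p^k) ∣ j, so ⌊n/α(p^k)⌋ counts the
-- j ∈ [1, n] with p^k ∣ C_j. Summing over k and exchanging the two finite sums gives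
-- Σ_j #{k ≥ 1 : p^k ∣ C_j} = Σ_j ν_p(C_j) = ν_p(n!_C). Only finitely many k contribute: once
-- k ≥ |C_1| + ⋯ + |C_n| we have p^k > k ≥ |C_j| ≠ 0, so p^k divides none of C_1, …, C_n.
module Submission where

open import Defs
open import Algebra.Properties.CommutativeSemigroup using (interchange)
open import Data.Integer using (ℤ; +_; ∣_∣; 1ℤ) renaming (_*_ to _*ℤ_)
open import Data.Integer.Divisibility using (_∣_)
import Data.Integer.GCD as ℤ
import Data.Integer.Properties as ℤ
open import Data.Maybe using (Maybe; just; nothing)
open import Data.Nat
  using ( ℕ; zero; suc; _+_; _*_; _^_; _≤_; _<_; _/_; _%_; NonZero; z≤n; s≤s; z<s
        ; _≤′_; ≤′-refl; ≤′-step; ≢-nonZero; >-nonZero; nonTrivial⇒n>1 )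
open import Data.Nat.Divisibility
  using ( divides; ∣-trans; ∣-refl; _∣?_; ∣⇒≤; ∣-antisym; 1∣_
        ; *-monoʳ-∣; *-monoˡ-∣; *-cancelʳ-∣; ∣m+n∣m⇒∣n; n∣m*n )
  renaming (_∣_ to _∣ℕ_)
open import Data.Nat.DivMod
  using (m≡m%n+[m/n]*n; m%n<n; +-distrib-/-∣ˡ; m*n/n≡m; m<n⇒m/n≡0; 0/n≡0)
open import Data.Nat.GCD using (gcd; gcd[m,n]∣m; gcd[m,n]∣n; gcd-greatest; gcd[m,n]≢0)
open import Data.Nat.Primality using (Prime; euclidsLemma; prime⇒nonZero; prime⇒nonTrivial)
open import Data.Nat.Properties
open import Data.Product using (∃; _×_; _,_)
open import Data.Sum using (inj₁; inj₂; [_,_])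
open import Function using (_∘_; _⇔_; mk⇔; Equivalence)
open import Relation.Nullary using (¬_; Dec; yes; no; contradiction)
open import Relation.Binary.PropositionalEquality hiding ([_])

indicator : {P : Set} → Dec P → ℕ
indicator (yes _) = 1
indicator (no _)  = 0

indicator-yes : {P : Set} (P? : Dec P) → P → indicator P? ≡ 1
indicator-yes (yes _) _  = refl
indicator-yes (no ¬p) p = contradiction p ¬p

indicator-no : {P : Set} (P? : Dec P) → ¬ P → indicator P? ≡ 0
indicator-no (yes p) ¬p = contradiction p ¬p
indicator-no (no _)  _  = refl

indicator-⇔ : {P Q : Set} (P? : Dec P) (Q? : Dec Q) → P ⇔ Q → indicator P? ≡ indicator Q?
indicator-⇔ (yes p) Q? P⇔Q = sym (indicator-yes Q? (Equivalence.to P⇔Q p))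
indicator-⇔ (no ¬p) Q? P⇔Q = sym (indicator-no Q? (¬p ∘ Equivalence.from P⇔Q))

sumFrom1-cong : ∀ {f g} K → (∀ k → 1 ≤ k → k ≤ K → f k ≡ g k) → sumFrom1 f K ≡ sumFrom1 g K
sumFrom1-cong zero    f≡g = refl
sumFrom1-cong (suc K) f≡g =
  cong₂ _+_ (sumFrom1-cong K (λ k 1≤k k≤K → f≡g k 1≤k (m≤n⇒m≤1+n k≤K))) (f≡g (suc K) z<s ≤-refl)

sumFrom1-zero : ∀ {f} K → (∀ k → 1 ≤ k → k ≤ K → f k ≡ 0) → sumFrom1 f K ≡ 0
sumFrom1-zero zero    _   = refl
sumFrom1-zero (suc K) f≡0 =
  cong₂ _+_ (sumFrom1-zero K (λ k 1≤k k≤K → f≡0 k 1≤k (m≤n⇒m≤1+n k≤K))) (f≡0 (suc K) z<s ≤-refl)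

sumFrom1-+ : ∀ f g K → sumFrom1 (λ k → f k + g k) K ≡ sumFrom1 f K + sumFrom1 g K
sumFrom1-+ f g zero    = refl
sumFrom1-+ f g (suc K) = begin
  sumFrom1 (λ k → f k + g k) K + (f (suc K) + g (suc K))
    ≡⟨ cong (_+ (f (suc K) + g (suc K))) (sumFrom1-+ f g K) ⟩
  (sumFrom1 f K + sumFrom1 g K) + (f (suc K) + g (suc K))
    ≡⟨ interchange +-commutativeSemigroup (sumFrom1 f K) _ _ _ ⟩
  (sumFrom1 f K + f (suc K)) + (sumFrom1 g K + g (suc K)) ∎
  where open ≡-Reasoning

sumFrom1-swap : ∀ (f : ℕ → ℕ → ℕ) K n →
  sumFrom1 (λ k → sumFrom1 (f k) n) K ≡ sumFrom1 (λ j → sumFrom1 (λ k → f k j) K) n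
sumFrom1-swap f zero    n = sym (sumFrom1-zero n (λ _ _ _ → refl))
sumFrom1-swap f (suc K) n = begin
  sumFrom1 (λ k → sumFrom1 (f k) n) K + sumFrom1 (f (suc K)) n
    ≡⟨ cong (_+ sumFrom1 (f (suc K)) n) (sumFrom1-swap f K n) ⟩
  sumFrom1 (λ j → sumFrom1 (λ k → f k j) K) n + sumFrom1 (f (suc K)) n
    ≡⟨ sumFrom1-+ (λ j → sumFrom1 (λ k → f k j) K) (f (suc K)) n ⟨
  sumFrom1 (λ j → sumFrom1 (λ k → f k j) (suc K)) n ∎
  where open ≡-Reasoning

term≤sumFrom1 : ∀ f {j n} → 1 ≤ j → j ≤ n → f j ≤ sumFrom1 f n
term≤sumFrom1 f {suc _} {zero} _ ()
term≤sumFrom1 f {j} {suc n} 1≤j j≤1+n with m≤n⇒m<n∨m≡n j≤1+n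
... | inj₁ j<1+n = ≤-trans (term≤sumFrom1 f 1≤j (≤-pred j<1+n)) (m≤m+n _ _)
... | inj₂ refl  = m≤n+m _ _

sumFrom1-stable : ∀ {f K K'} → (∀ k → K < k → f k ≡ 0) → K ≤′ K' → sumFrom1 f K' ≡ sumFrom1 f K
sumFrom1-stable f≡0 ≤′-refl = refl
sumFrom1-stable {f} {K} {suc K'} f≡0 (≤′-step K≤′K') = begin
  sumFrom1 f K' + f (suc K') ≡⟨ cong (_+_ (sumFrom1 f K')) (f≡0 (suc K') (s≤s (≤′⇒≤ K≤′K'))) ⟩
  sumFrom1 f K' + 0          ≡⟨ +-identityʳ _ ⟩
  sumFrom1 f K'              ≡⟨ sumFrom1-stable f≡0 K≤′K' ⟩
  sumFrom1 f K               ∎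
  where open ≡-Reasoning

vanishing-tail⇒HasSum : ∀ {f} K → (∀ k → K < k → f k ≡ 0) → HasSum f (sumFrom1 f K)
vanishing-tail⇒HasSum K f≡0 = K , λ K' K≤K' → sumFrom1-stable f≡0 (≤⇒≤′ K≤K')

[1+m]/n≡m/n+[n∣1+m] : ∀ m n .{{_ : NonZero n}} → suc m / n ≡ m / n + indicator (n ∣? suc m)
[1+m]/n≡m/n+[n∣1+m] m n with m≤n⇒m<n∨m≡n (m%n<n m n)
... | inj₁ 1+r<n = begin
  suc m / n                                ≡⟨ cong (_/ n) 1+m≡qn+1+r ⟩
  (m / n * n + suc (m % n)) / n            ≡⟨ +-distrib-/-∣ˡ (suc (m % n)) (n∣m*n (m / n)) ⟩
  m / n * n / n + suc (m % n) / n          ≡⟨ cong₂ _+_ (m*n/n≡m (m / n) n) (m<n⇒m/n≡0 1+r<n) ⟩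
  m / n + 0                                ≡⟨ cong (_+_ (m / n)) (indicator-no (n ∣? suc m) n∤1+m) ⟨
  m / n + indicator (n ∣? suc m)           ∎
  where
  open ≡-Reasoning
  1+m≡qn+1+r : suc m ≡ m / n * n + suc (m % n)
  1+m≡qn+1+r = trans (cong suc (m≡m%n+[m/n]*n m n)) (+-comm (suc (m % n)) (m / n * n))
  n∤1+m : ¬ n ∣ℕ suc m
  n∤1+m n∣1+m = <⇒≱ 1+r<n (∣⇒≤ n∣1+r)
    where
    n∣1+r : n ∣ℕ suc (m % n)
    n∣1+r = ∣m+n∣m⇒∣n (subst (n ∣ℕ_) 1+m≡qn+1+r n∣1+m) (n∣m*n (m / n))
... | inj₂ 1+r≡n = begin
  suc m / n                                ≡⟨ cong (_/ n) 1+m≡[1+q]n ⟩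
  suc (m / n) * n / n                      ≡⟨ m*n/n≡m (suc (m / n)) n ⟩
  suc (m / n)                              ≡⟨ +-comm 1 (m / n) ⟩
  m / n + 1                                ≡⟨ cong (_+_ (m / n)) (indicator-yes (n ∣? suc m) n∣1+m) ⟨
  m / n + indicator (n ∣? suc m)           ∎
  where
  open ≡-Reasoning
  1+m≡[1+q]n : suc m ≡ suc (m / n) * n
  1+m≡[1+q]n = trans (cong suc (m≡m%n+[m/n]*n m n)) (cong (_+ m / n * n) 1+r≡n)
  n∣1+m : n ∣ℕ suc m
  n∣1+m = divides (suc (m / n)) 1+m≡[1+q]n

^-monoʳ-∣ : ∀ p {m n} → m ≤ n → p ^ m ∣ℕ p ^ n
^-monoʳ-∣ p {n = n} z≤n       = 1∣ (p ^ n)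
^-monoʳ-∣ p         (s≤s m≤n) = *-monoʳ-∣ p (^-monoʳ-∣ p m≤n)

powersDividing : ℕ → ℕ → ℤ → ℕ
powersDividing p K x = sumFrom1 (λ k → indicator (p ^ k ∣? ∣ x ∣)) K

powersDividing-all : ∀ p K {x} → + (p ^ K) ∣ x → powersDividing p K x ≡ K
powersDividing-all p zero    _ = refl
powersDividing-all p (suc K) {x} p^1+K∣x = begin
  powersDividing p K x + indicator (p ^ suc K ∣? ∣ x ∣)
    ≡⟨ cong₂ _+_ (powersDividing-all p K {x} p^K∣x)
                 (indicator-yes (p ^ suc K ∣? ∣ x ∣) p^1+K∣x) ⟩
  K + 1
    ≡⟨ +-comm K 1 ⟩
  suc K ∎
  where
  open ≡-Reasoning
  p^K∣x : + (p ^ K) ∣ x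
  p^K∣x = ∣-trans (^-monoʳ-∣ p (n≤1+n K)) p^1+K∣x

powersDividing-valuation : ∀ p K {x} → ¬ (+ (p ^ K) ∣ x) → IsValuation p x (powersDividing p K x)
powersDividing-valuation p zero    {x} p^0∤x = contradiction (1∣ ∣ x ∣) p^0∤x
powersDividing-valuation p (suc K) {x} p^1+K∤x =
  subst (IsValuation p x) (sym last-term-vanishes) valuation
  where
  last-term-vanishes : powersDividing p (suc K) x ≡ powersDividing p K x
  last-term-vanishes =
    trans (cong (_+_ (powersDividing p K x)) (indicator-no (p ^ suc K ∣? ∣ x ∣) p^1+K∤x))
          (+-identityʳ _)
  valuation : IsValuation p x (powersDividing p K x)
  valuation with p ^ K ∣? ∣ x ∣
  ... | yes p^K∣x =
    subst (IsValuation p x) (sym (powersDividing-all p K {x} p^K∣x)) (p^K∣x , p^1+K∤x)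
  ... | no  p^K∤x = powersDividing-valuation p K {x} p^K∤x

module _ {p : ℕ} (p-prime : Prime p) where

  private instance
    p≢0 : NonZero p
    p≢0 = prime⇒nonZero p-prime

  n<p^n : ∀ n → n < p ^ n
  n<p^n zero    = z<s
  n<p^n (suc n) = ≤-<-trans (n<p^n n) (^-monoʳ-< p 1<p (n<1+n n))
    where
    1<p : 1 < p
    1<p = nonTrivial⇒n>1 p {{prime⇒nonTrivial p-prime}}

  ∣x∣≤k⇒p^k∤x : ∀ {x k} → x ≢ + 0 → ∣ x ∣ ≤ k → ¬ (+ (p ^ k) ∣ x)
  ∣x∣≤k⇒p^k∤x {x} {k} x≢0 ∣x∣≤k p^k∣x = <⇒≱ (n<p^n k) (≤-trans p^k≤∣x∣ ∣x∣≤k)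
    where
    p^k≤∣x∣ : p ^ k ≤ ∣ x ∣
    p^k≤∣x∣ = ∣⇒≤ {{≢-nonZero (x≢0 ∘ ℤ.∣i∣≡0⇒i≡0)}} p^k∣x

  ¬p∣cofactor : ∀ {x x' u} → x ≡ x' * p ^ u → ¬ p ^ suc u ∣ℕ x → ¬ p ∣ℕ x'
  ¬p∣cofactor {u = u} x≡x'p^u p^1+u∤x p∣x' =
    p^1+u∤x (subst (p ^ suc u ∣ℕ_) (sym x≡x'p^u) (*-monoˡ-∣ (p ^ u) p∣x'))

  valuation-* : ∀ {x y u v} → IsValuation p x u → IsValuation p y v →
                IsValuation p (x *ℤ y) (u + v)
  valuation-* {x} {y} {u} {v}
              (divides x' ∣x∣≡x'p^u , p^1+u∤x) (divides y' ∣y∣≡y'p^v , p^1+v∤y) =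
    subst (λ z → IsValuation p (+ z) (u + v)) (sym (ℤ.abs-* x y))
          (divides (x' * y') ∣x∣∣y∣≡x'y'p^[u+v] , p^1+[u+v]∤∣x∣∣y∣)
    where
    ∣x∣∣y∣≡x'y'p^[u+v] : ∣ x ∣ * ∣ y ∣ ≡ x' * y' * p ^ (u + v)
    ∣x∣∣y∣≡x'y'p^[u+v] = begin
      ∣ x ∣ * ∣ y ∣             ≡⟨ cong₂ _*_ ∣x∣≡x'p^u ∣y∣≡y'p^v ⟩
      x' * p ^ u * (y' * p ^ v) ≡⟨ interchange *-commutativeSemigroup x' (p ^ u) y' (p ^ v) ⟩
      x' * y' * (p ^ u * p ^ v) ≡⟨ cong (x' * y' *_) (^-distribˡ-+-* p u v) ⟨
      x' * y' * p ^ (u + v)     ∎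
      where open ≡-Reasoning
    p^1+[u+v]∤∣x∣∣y∣ : ¬ p ^ suc (u + v) ∣ℕ ∣ x ∣ * ∣ y ∣
    p^1+[u+v]∤∣x∣∣y∣ p^1+[u+v]∣∣x∣∣y∣ =
      [ ¬p∣cofactor {u = u} ∣x∣≡x'p^u p^1+u∤x , ¬p∣cofactor {u = v} ∣y∣≡y'p^v p^1+v∤y ]
        (euclidsLemma x' y' p-prime p∣x'y')
      where
      p∣x'y' : p ∣ℕ x' * y'
      p∣x'y' = *-cancelʳ-∣ (p ^ (u + v)) {{m^n≢0 p (u + v)}}
                 (subst (p ^ suc (u + v) ∣ℕ_) ∣x∣∣y∣≡x'y'p^[u+v] p^1+[u+v]∣∣x∣∣y∣)

  valuation-1 : IsValuation p 1ℤ 0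
  valuation-1 = 1∣ 1 , λ p^1∣1 → <⇒≱ (n<p^n 1) (∣⇒≤ p^1∣1)

  orial-valuation : ∀ {C v} n → (∀ j → 1 ≤ j → j ≤ n → IsValuation p (C j) (v j)) →
                    IsValuation p (orial C n) (sumFrom1 v n)
  orial-valuation zero    _ = valuation-1
  orial-valuation {C} {v} (suc n) ν =
    subst (IsValuation p (orial C (suc n))) (+-comm (v (suc n)) (sumFrom1 v n))
      (valuation-* {C (suc n)} {orial C n} {v (suc n)} {sumFrom1 v n} (ν (suc n) z<s ≤-refl) ν-orial)
    where
    ν-orial : IsValuation p (orial C n) (sumFrom1 v n)
    ν-orial = orial-valuation {C} {v} n (λ j 1≤j j≤n → ν j 1≤j (m≤n⇒m≤1+n j≤n))

module _ {C : ℕ → ℤ} (sds : IsStrongDivSeq C) where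

  open IsStrongDivSeq sds

  ∣⇒term-∣ : ∀ {i j} → 1 ≤ i → 1 ≤ j → i ∣ℕ j → C i ∣ C j
  ∣⇒term-∣ {i} {j} 1≤i 1≤j i∣j = subst (λ g → C g ∣ C j) gcd[j,i]≡i C[gcd[j,i]]∣Cj
    where
    gcd[j,i]≡i : gcd j i ≡ i
    gcd[j,i]≡i = ∣-antisym (gcd[m,n]∣n j i) (gcd-greatest i∣j ∣-refl)
    C[gcd[j,i]]∣Cj : C (gcd j i) ∣ C j
    C[gcd[j,i]]∣Cj = subst (_∣ C j) (sdiv j i 1≤j 1≤i) (ℤ.gcd[i,j]∣i (C j) (C i))

  ∣-terms⇒∣-gcd-term : ∀ {d i j} → 1 ≤ i → 1 ≤ j → d ∣ C i → d ∣ C j → d ∣ C (gcd i j)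
  ∣-terms⇒∣-gcd-term {d} {i} {j} 1≤i 1≤j d∣Ci d∣Cj =
    subst (d ∣_) (sdiv i j 1≤i 1≤j) (ℤ.gcd-greatest {C i} {C j} {d} d∣Ci d∣Cj)

  rank-∣⇔ : ∀ {m a j} → Rank C m (just a) → 1 ≤ j → a ∣ℕ j ⇔ + m ∣ C j
  rank-∣⇔ {m} {a} {j} (1≤a , m∣Ca , below-rank⇒∤) 1≤j = mk⇔ a∣j⇒m∣Cj m∣Cj⇒a∣j
    where
    a∣j⇒m∣Cj : a ∣ℕ j → + m ∣ C j
    a∣j⇒m∣Cj a∣j = ∣-trans m∣Ca (∣⇒term-∣ 1≤a 1≤j a∣j)
    m∣Cj⇒a∣j : + m ∣ C j → a ∣ℕ j
    m∣Cj⇒a∣j m∣Cj = subst (_∣ℕ j) gcd[j,a]≡a (gcd[m,n]∣m j a)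
      where
      1≤gcd[j,a] : 1 ≤ gcd j a
      1≤gcd[j,a] = n≢0⇒n>0 (gcd[m,n]≢0 j a (inj₂ (n>0⇒n≢0 1≤a)))
      m∣C[gcd[j,a]] : + m ∣ C (gcd j a)
      m∣C[gcd[j,a]] = ∣-terms⇒∣-gcd-term {+ m} 1≤j 1≤a m∣Cj m∣Ca
      gcd[j,a]≮a : ¬ gcd j a < a
      gcd[j,a]≮a gcd[j,a]<a = below-rank⇒∤ (gcd j a) 1≤gcd[j,a] gcd[j,a]<a m∣C[gcd[j,a]]
      gcd[j,a]≡a : gcd j a ≡ a
      gcd[j,a]≡a = ≤-antisym (∣⇒≤ {{>-nonZero 1≤a}} (gcd[m,n]∣n j a)) (≮⇒≥ gcd[j,a]≮a)

  floorDivRank-suc : ∀ {m} r n → Rank C m r →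
                     floorDivRank (suc n) r ≡ floorDivRank n r + indicator (m ∣? ∣ C (suc n) ∣)
  floorDivRank-suc {m} nothing        n never-∣ =
    sym (indicator-no (m ∣? ∣ C (suc n) ∣) (never-∣ (suc n) z<s))
  floorDivRank-suc     (just zero)    n (() , _)
  floorDivRank-suc {m} (just (suc a)) n rank =
    trans ([1+m]/n≡m/n+[n∣1+m] n (suc a))
          (cong (_+_ (n / suc a))
                (indicator-⇔ (suc a ∣? suc n) (m ∣? ∣ C (suc n) ∣) (rank-∣⇔ rank z<s)))

  floorDivRank-counts : ∀ {m} r n → Rank C m r →
                        floorDivRank n r ≡ sumFrom1 (λ j → indicator (m ∣? ∣ C j ∣)) n
  floorDivRank-counts nothing        zero _ = refl
  floorDivRank-counts (just zero)    zero _ = refl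
  floorDivRank-counts (just (suc a)) zero _ = 0/n≡0 (suc a)
  floorDivRank-counts {m} r (suc n) rank =
    trans (floorDivRank-suc r n rank)
          (cong (_+ indicator (m ∣? ∣ C (suc n) ∣)) (floorDivRank-counts r n rank))

proposition2p1 : (C : ℕ → ℤ) → IsStrongDivSeq C → (p : ℕ) → Prime p →
    (α : ℕ → Maybe ℕ) → (∀ k → 1 ≤ k → Rank C (p ^ k) (α k)) →
    (n : ℕ) →
    ∃ λ s → HasSum (λ k → floorDivRank n (α k)) s × IsValuation p (orial C n) s
proposition2p1 C sds p p-prime α rank n =
  sumFrom1 ⌊n/α⌋ K , vanishing-tail⇒HasSum K tail ,
  subst (IsValuation p (orial C n)) (sym sum≡Σvaluations) (orial-valuation p-prime n valuation)
  where
  open IsStrongDivSeq sds using (nonzero)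
  ⌊n/α⌋ : ℕ → ℕ
  ⌊n/α⌋ k = floorDivRank n (α k)
  K : ℕ
  K = sumFrom1 (λ j → ∣ C j ∣) n
  p^k∤C : ∀ {j k} → 1 ≤ j → j ≤ n → K ≤ k → ¬ (+ (p ^ k) ∣ C j)
  p^k∤C {j} 1≤j j≤n K≤k =
    ∣x∣≤k⇒p^k∤x p-prime (nonzero j 1≤j) (≤-trans (term≤sumFrom1 (λ j → ∣ C j ∣) 1≤j j≤n) K≤k)
  ⌊n/α⌋≡count : ∀ k → 1 ≤ k → ⌊n/α⌋ k ≡ sumFrom1 (λ j → indicator (p ^ k ∣? ∣ C j ∣)) n
  ⌊n/α⌋≡count k 1≤k = floorDivRank-counts sds (α k) n (rank k 1≤k)
  tail : ∀ k → K < k → ⌊n/α⌋ k ≡ 0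
  tail k K<k = trans (⌊n/α⌋≡count k (≤-trans (s≤s z≤n) K<k))
    (sumFrom1-zero n (λ j 1≤j j≤n → indicator-no (p ^ k ∣? ∣ C j ∣) (p^k∤C 1≤j j≤n (<⇒≤ K<k))))
  sum≡Σvaluations : sumFrom1 ⌊n/α⌋ K ≡ sumFrom1 (λ j → powersDividing p K (C j)) n
  sum≡Σvaluations = trans (sumFrom1-cong K (λ k 1≤k _ → ⌊n/α⌋≡count k 1≤k))
                          (sumFrom1-swap (λ k j → indicator (p ^ k ∣? ∣ C j ∣)) K n)
  valuation : ∀ j → 1 ≤ j → j ≤ n → IsValuation p (C j) (powersDividing p K (C j))
  valuation j 1≤j j≤n = powersDividing-valuation p K {C j} (p^k∤C 1≤j j≤n ≤-refl)
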